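{- Consider any execution of pdqsort (as described in the context) and any distinct value $v$. In the first call, in execution order, in which an element comparing equal to $v$ is selected as the pivot, the subarray is partitioned with partition_right, and every element of that call's subarray comparing equal to $v$ (other than the pivot itself) ends up in the right part $A[r+1..b)$.
   Context: Setting. The input is an array $A[0..n-1]$ of elements compared by a strict weak ordering $<$; $a,b$ compare equal if neither $a<b$ nor $b<a$ (an equivalence relation whose classes are called distinct values); $a\le b$ means "not $b<a$". pdqsort is the following recursive procedure acting in place on contiguous subarrays $A[a..b)=(A[a],\dots,A[b-1])$, each call carrying an integer counter $t$; the top-level call is on $A[0..n)$ with $t=\lfloor\log_2 n\rfloor$. A subarray $A[a..b)$ is leftmost if $a=0$; otherwise its predecessor is the element currently at position $a-1$. Fixed constants are an insertion-sort threshold $c\ge3$, a parameter $p\in(0,1)$, and a constant move bound. A call on $A[a..b)$ with $m=b-a$ does: (1) if $m\le c$, insertion sort $A[a..b)$ and return; (2) if $t=0$, heapsort $A[a..b)$ and return; (3) select a pivot $q$ as the median of at least three sampled elements of $A[a..b)$ by a deterministic rule, and move it to position $a$; (4) if $a>0$ and the predecessor compares equal to $q$, apply partition_left: rearrange $A[a..b)$ so that $q$ ends at a position $r$, all elements of $A[a..r)$ are $\le q$ and all elements of $A[r+1..b)$ are $>q$; otherwise apply partition_right: rearrange so that $q$ ends at a position $r$, all elements of $A[a..r)$ are $<q$ and all of $A[r+1..b)$ are $\ge q$; (5) the partition is bad if $\min(r-a,b-r-1)<pm$; if bad, set $t:=t-1$ and swap $O(1)$ elements at fixed relative positions inside each of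 the two parts; (6) if partition_right was applied, the partition is not bad, and no element other than the pivot was moved, run on both parts an insertion sort that aborts after the constant number of moves; if both complete, return; (7) if partition_left was applied, recurse only on $A[r+1..b)$; otherwise recurse on $A[a..r)$ and then on $A[r+1..b)$, each with counter $t$.
   Formalization: The parameter p is a rational number in (0,1). -}

module Defs where

open import Level using (Level; _⊔_)
open import Data.Nat using (ℕ; zero; suc; pred; _+_; _*_; _∸_; _≤_; _<_)
open import Data.Nat.Properties using ()
open import Data.List using (List; []; _∷_; _++_; length)
open import Data.List.Relation.Unary.All using (All)
open import Data.List.Relation.Unary.Unique.Propositional using (Unique)
open import Data.List.Membership.Propositional using (_∈_)
open import Data.List.Relation.Binary.Permutation.Propositional using (_↭_)
open import Data.Product using (Σ; _×_; _,_; ∃)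
open import Data.Sum using (_⊎_)
open import Relation.Nullary using (¬_)
open import Relation.Binary.PropositionalEquality using (_≡_)

Incomparable : ∀ {a ℓ} {C : Set a} → (C → C → Set ℓ) → C → C → Set ℓ
Incomparable _<_ x y = ¬ (x < y) × ¬ (y < x)

record IsStrictWeakOrder {a ℓ} {C : Set a} (_<_ : C → C → Set ℓ) : Set (a ⊔ ℓ) where
  field
    irrefl       : ∀ x → ¬ (x < x)
    trans        : ∀ {x y z} → x < y → y < z → x < z
    incomp-trans : ∀ {x y z} → Incomparable _<_ x y → Incomparable _<_ y z →
                   Incomparable _<_ x z

-- Executions of pdqsort.
--   c       : insertion-sort threshold
--   pn / pd : the parameter p (p = pn / pd, a rational in (0,1))
-- The array is modelled as a function ℕ → C; a call only ever touches
-- positions in its range [a, b), the top-level call is on [0, n).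

module PDQ {a ℓ} (C : Set a) (_≺_ : C → C → Set ℓ) (c pn pd : ℕ) where

  Arr : Set a
  Arr = ℕ → C

  _≈_ : C → C → Set ℓ
  _≈_ = Incomparable _≺_

  _≤ₑ_ : C → C → Set ℓ
  x ≤ₑ y = ¬ (y ≺ x)

  RearrBy : (ℕ → ℕ) → ℕ → ℕ → Arr → Arr → Set a
  RearrBy σ lo hi A A' =
    Σ (ℕ → ℕ) λ τ →
      (∀ i → σ (τ i) ≡ i) × (∀ i → τ (σ i) ≡ i) ×
      (∀ i → (i < lo ⊎ hi ≤ i) → σ i ≡ i) ×
      (∀ i → A' i ≡ A (σ i))

  Rearr : ℕ → ℕ → Arr → Arr → Set a
  Rearr lo hi A A' = Σ (ℕ → ℕ) λ σ → RearrBy σ lo hi A A'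

  Sorted : ℕ → ℕ → Arr → Set ℓ
  Sorted lo hi A = ∀ i j → lo ≤ i → i < j → j < hi → A i ≤ₑ A j

  IsMedian : Arr → List ℕ → ℕ → Set ℓ
  IsMedian A S j =
    Σ (List ℕ) λ L → Σ (List ℕ) λ R →
      (S ↭ (L ++ j ∷ R)) ×
      All (λ i → A i ≤ₑ A j) L × All (λ i → A j ≤ₑ A i) R ×
      (length L ≡ length R ⊎ suc (length L) ≡ length R ⊎ length L ≡ suc (length R))

  -- step (3): a median of at least three sampled (distinct) positions of
  -- A[lo..hi) is chosen and moved to position lo
  PivotSel : ℕ → ℕ → Arr → Arr → Set (a ⊔ ℓ)
  PivotSel lo hi A A1 =
    Σ (List ℕ) λ S → Σ ℕ λ j →
      (3 ≤ length S) × Unique S × All (λ i → lo ≤ i × i < hi) S ×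
      (j ∈ S) × IsMedian A S j ×
      Σ (ℕ → ℕ) λ σ → RearrBy σ lo hi A A1 × σ lo ≡ j

  PredEq : ℕ → Arr → Set ℓ
  PredEq lo A1 = 0 < lo × A1 (pred lo) ≈ A1 lo

  PartLeft : ℕ → ℕ → ℕ → Arr → Arr → Set (a ⊔ ℓ)
  PartLeft lo hi r A1 A2 =
    Σ (ℕ → ℕ) λ σ → RearrBy σ lo hi A1 A2 ×
      lo ≤ r × r < hi × σ r ≡ lo ×
      (∀ i → lo ≤ i → i < r → A2 i ≤ₑ A1 lo) ×
      (∀ i → r < i → i < hi → A1 lo ≺ A2 i)

  PartRight : ℕ → ℕ → ℕ → Arr → Arr → Set (a ⊔ ℓ)
  PartRight lo hi r A1 A2 =
    Σ (ℕ → ℕ) λ σ → RearrBy σ lo hi A1 A2 ×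
      lo ≤ r × r < hi × σ r ≡ lo ×
      (∀ i → lo ≤ i → i < r → A2 i ≺ A1 lo) ×
      (∀ i → r < i → i < hi → A1 lo ≤ₑ A2 i)

  min : ℕ → ℕ → ℕ
  min zero    _       = zero
  min (suc x) zero    = zero
  min (suc x) (suc y) = suc (min x y)

  Bad : ℕ → ℕ → ℕ → Set
  Bad lo hi r = pd * min (r ∸ lo) (hi ∸ suc r) < pn * (hi ∸ lo)

  PartsRearr : ℕ → ℕ → ℕ → Arr → Arr → Set a
  PartsRearr lo hi r A A' = Σ Arr λ B → Rearr lo r A B × Rearr (suc r) hi B A'

  -- step (5): counter update and swaps (k+1 is the counter of the call)
  data BadStep (k lo hi r : ℕ) (A2 : Arr) : Arr → ℕ → Set (a ⊔ ℓ) where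
    bad    : ∀ {A3} → Bad lo hi r → PartsRearr lo hi r A2 A3 → BadStep k lo hi r A2 A3 k
    notBad : ¬ Bad lo hi r → BadStep k lo hi r A2 A2 (suc k)

  data Kind : Set where
    left right : Kind

  record Event : Set a where
    constructor event
    field
      lo hi : ℕ
      kind  : Kind
      pivot : C
      r     : ℕ      -- final position of the pivot
      arr   : Arr    -- the array right after partitioning

  -- Exec t lo hi A A' es : the call on A[lo..hi) with counter t, started on
  -- array A, ends with array A'; es lists, in execution order, the pivot
  -- selections/partitions performed during this call and its sub-calls.
  data Exec : ℕ → ℕ → ℕ → Arr → Arr → List Event → Set (a ⊔ ℓ) where
    insertion : ∀ {t lo hi A A'} → hi ∸ lo ≤ c →
      Rearr lo hi A A' → Sorted lo hi A' → Exec t lo hi A A' []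
    heapsort : ∀ {lo hi A A'} → c < hi ∸ lo →
      Rearr lo hi A A' → Sorted lo hi A' → Exec 0 lo hi A A' []
    -- (3),(4) partition_left,(5),(7)
    partLeft : ∀ {k lo hi A A1 r A2 A3 t' A4 es} → c < hi ∸ lo →
      PivotSel lo hi A A1 → PredEq lo A1 →
      PartLeft lo hi r A1 A2 → BadStep k lo hi r A2 A3 t' →
      Exec t' (suc r) hi A3 A4 es →
      Exec (suc k) lo hi A A4 (event lo hi left (A1 lo) r A2 ∷ es)
    -- (3),(4) partition_right,(5),(6) with both partial insertion sorts completing
    partRightDone : ∀ {k lo hi A A1 r A2 A3} → c < hi ∸ lo →
      PivotSel lo hi A A1 → ¬ PredEq lo A1 →
      PartRight lo hi r A1 A2 → ¬ Bad lo hi r →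
      PartsRearr lo hi r A2 A3 → Sorted lo r A3 → Sorted (suc r) hi A3 →
      Exec (suc k) lo hi A A3 (event lo hi right (A1 lo) r A2 ∷ [])
    -- (3),(4) partition_right,(5),(6) not attempted,(7)
    partRight : ∀ {k lo hi A A1 r A2 A3 t' A4 A5 es₁ es₂} → c < hi ∸ lo →
      PivotSel lo hi A A1 → ¬ PredEq lo A1 →
      PartRight lo hi r A1 A2 → BadStep k lo hi r A2 A3 t' →
      Exec t' lo r A3 A4 es₁ → Exec t' (suc r) hi A4 A5 es₂ →
      Exec (suc k) lo hi A A5 (event lo hi right (A1 lo) r A2 ∷ es₁ ++ es₂)
    -- (3),(4) partition_right,(5),(6) attempted but aborted,(7)
    partRightAbort : ∀ {k lo hi A A1 r A2 A3 A4 A5 es₁ es₂} → c < hi ∸ lo →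
      PivotSel lo hi A A1 → ¬ PredEq lo A1 →
      PartRight lo hi r A1 A2 → ¬ Bad lo hi r →
      PartsRearr lo hi r A2 A3 →
      Exec (suc k) lo r A3 A4 es₁ → Exec (suc k) (suc r) hi A4 A5 es₂ →
      Exec (suc k) lo hi A A5 (event lo hi right (A1 lo) r A2 ∷ es₁ ++ es₂)

{-# OPTIONS --safe #-}
-- Every call runs with the invariant that the predecessor of its subarray
-- does not compare equal to v, as long as no pivot equal to v has been
-- selected before it.  The invariant survives the recursion because a call
-- and its sub-calls only touch positions inside their own subarray: the left
-- part inherits the caller's predecessor, and the predecessor of the right
-- part is the caller's pivot.  Hence the first call choosing a pivot q ≈ v
-- cannot see a predecessor equal to q, so it uses partition_right, which
-- puts only elements strictly below q to the left of q.
module Submission where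

open import Defs
open import Level using (_⊔_)
open import Data.Nat using (ℕ; _≤_; _<_; zero; suc)
open import Data.Nat.Properties using (≤-trans; <-≤-trans; <⇒≤; m≤n⇒m≤1+n; ≤-refl; n<1+n; <-cmp)
open import Data.Nat.Logarithm using (⌊log₂_⌋)
open import Data.List using (List; []; _∷_; _++_)
open import Data.List.Relation.Unary.All using (All; []; _∷_)
open import Data.Product using (_×_; _,_; proj₁)
open import Data.Sum using (_⊎_; inj₁; inj₂)
open import Data.Empty using (⊥-elim)
open import Function using (id; _∘_)
open import Relation.Nullary using (¬_)
open import Relation.Binary.Definitions using (tri<; tri≈; tri>)
open import Relation.Binary.PropositionalEquality
  using (_≡_; _≢_; refl; trans; cong; subst; module ≡-Reasoning)

AtFirst : ∀ {a q r} {X : Set a} → (X → Set q) → (X → Set r) → List X → Set (a ⊔ q ⊔ r)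
AtFirst Q R xs = ∀ pre x post → xs ≡ pre ++ x ∷ post → All (¬_ ∘ Q) pre → Q x → R x

module _ {a q r} {X : Set a} {Q : X → Set q} {R : X → Set r} where

  atFirst-[] : AtFirst Q R []
  atFirst-[] [] _ _ ()
  atFirst-[] (_ ∷ _) _ _ ()

  atFirst-∷ : ∀ {x xs} → (Q x → R x) → (¬ Q x → AtFirst Q R xs) → AtFirst Q R (x ∷ xs)
  atFirst-∷ head _ []          _ _ refl []          qx = head qx
  atFirst-∷ _ tail (_ ∷ pre) y post refl (¬qx ∷ al) qy = tail ¬qx pre y post refl al qy

  atFirst-head : ∀ {x xs} → AtFirst Q R (x ∷ xs) → Q x → R x
  atFirst-head {x} {xs} h = h [] x xs refl []

  atFirst-tail : ∀ {x xs} → AtFirst Q R (x ∷ xs) → ¬ Q x → AtFirst Q R xs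
  atFirst-tail {x} h ¬qx pre y post eq al = h (x ∷ pre) y post (cong (x ∷_) eq) (¬qx ∷ al)

  atFirst-++ : ∀ {xs ys} → AtFirst Q R xs → AtFirst Q R ys → AtFirst Q R (xs ++ ys)
  atFirst-++ {[]}    _ hys = hys
  atFirst-++ {_ ∷ _} hxs hys =
    atFirst-∷ (atFirst-head hxs) (λ ¬qx → atFirst-++ (atFirst-tail hxs ¬qx) hys)

module Frame {a ℓ} (C : Set a) (_≺_ : C → C → Set ℓ) (c pn pd : ℕ) where
  open PDQ C _≺_ c pn pd

  Outside : ℕ → ℕ → ℕ → Set
  Outside lo hi i = i < lo ⊎ hi ≤ i

  AgreeOutside : ℕ → ℕ → Arr → Arr → Set a
  AgreeOutside lo hi A B = ∀ i → Outside lo hi i → B i ≡ A i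

  outside-narrow : ∀ {lo lo′ hi′ hi i} → lo ≤ lo′ → hi′ ≤ hi →
    Outside lo hi i → Outside lo′ hi′ i
  outside-narrow lo≤lo′ _ (inj₁ i<lo) = inj₁ (<-≤-trans i<lo lo≤lo′)
  outside-narrow _ hi′≤hi (inj₂ hi≤i) = inj₂ (≤-trans hi′≤hi hi≤i)

  agreeOutside-widen : ∀ {lo lo′ hi′ hi A B} → lo ≤ lo′ → hi′ ≤ hi →
    AgreeOutside lo′ hi′ A B → AgreeOutside lo hi A B
  agreeOutside-widen lo≤lo′ hi′≤hi h i out = h i (outside-narrow lo≤lo′ hi′≤hi out)

  agreeOutside-trans : ∀ {lo hi A B D} →
    AgreeOutside lo hi A B → AgreeOutside lo hi B D → AgreeOutside lo hi A D
  agreeOutside-trans hAB hBD i out = trans (hBD i out) (hAB i out)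

  rearrBy⇒agreeOutside : ∀ {σ lo hi A B} → RearrBy σ lo hi A B → AgreeOutside lo hi A B
  rearrBy⇒agreeOutside {A = A} (_ , _ , _ , fixes , B≡A∘σ) i out =
    trans (B≡A∘σ i) (cong A (fixes i out))

  rearr⇒agreeOutside : ∀ {lo hi A B} → Rearr lo hi A B → AgreeOutside lo hi A B
  rearr⇒agreeOutside (_ , rb) = rearrBy⇒agreeOutside rb

  rearr-refl : ∀ {lo hi A} → Rearr lo hi A A
  rearr-refl = id , id , (λ _ → refl) , (λ _ → refl) , (λ _ _ → refl) , (λ _ → refl)

  pivotSel⇒agreeOutside : ∀ {lo hi A A1} → PivotSel lo hi A A1 → AgreeOutside lo hi A A1
  pivotSel⇒agreeOutside (_ , _ , _ , _ , _ , _ , _ , _ , rb , _) = rearrBy⇒agreeOutside rb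

  record MovesPivot (lo hi r : ℕ) (A1 A2 : Arr) : Set a where
    field
      lo≤r         : lo ≤ r
      r<hi         : r < hi
      agreeOutside : AgreeOutside lo hi A1 A2
      pivot-at-r   : A2 r ≡ A1 lo

  rearrBy⇒movesPivot : ∀ {σ lo hi r A1 A2} → RearrBy σ lo hi A1 A2 → lo ≤ r → r < hi →
    σ r ≡ lo → MovesPivot lo hi r A1 A2
  rearrBy⇒movesPivot {r = r} {A1} rb@(_ , _ , _ , _ , A2≡A1∘σ) lo≤r r<hi σr≡lo = record
    { lo≤r         = lo≤r
    ; r<hi         = r<hi
    ; agreeOutside = rearrBy⇒agreeOutside {A = A1} rb
    ; pivot-at-r   = trans (A2≡A1∘σ r) (cong A1 σr≡lo)
    }

  partLeft⇒movesPivot : ∀ {lo hi r A1 A2} → PartLeft lo hi r A1 A2 → MovesPivot lo hi r A1 A2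
  partLeft⇒movesPivot (_ , rb , lo≤r , r<hi , σr≡lo , _) = rearrBy⇒movesPivot rb lo≤r r<hi σr≡lo

  partRight⇒movesPivot : ∀ {lo hi r A1 A2} → PartRight lo hi r A1 A2 → MovesPivot lo hi r A1 A2
  partRight⇒movesPivot (_ , rb , lo≤r , r<hi , σr≡lo , _) = rearrBy⇒movesPivot rb lo≤r r<hi σr≡lo

  agreeOutside-parts : ∀ {lo hi r A B D} → lo ≤ r → r < hi →
    AgreeOutside lo r A B → AgreeOutside (suc r) hi B D → AgreeOutside lo hi A D
  agreeOutside-parts lo≤r r<hi lower upper = agreeOutside-trans
    (agreeOutside-widen ≤-refl (<⇒≤ r<hi) lower)
    (agreeOutside-widen (m≤n⇒m≤1+n lo≤r) ≤-refl upper)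

  partsRearr⇒agreeOutside : ∀ {lo hi r A B} → lo ≤ r → r < hi →
    PartsRearr lo hi r A B → AgreeOutside lo hi A B
  partsRearr⇒agreeOutside lo≤r r<hi (_ , lower , upper) =
    agreeOutside-parts lo≤r r<hi (rearr⇒agreeOutside lower) (rearr⇒agreeOutside upper)

  partsRearr-at-r : ∀ {lo hi r A B} → PartsRearr lo hi r A B → B r ≡ A r
  partsRearr-at-r {r = r} (_ , lower , upper) =
    trans (rearr⇒agreeOutside upper r (inj₁ (n<1+n r))) (rearr⇒agreeOutside lower r (inj₂ ≤-refl))

  badStep⇒partsRearr : ∀ {k lo hi r A B t} → BadStep k lo hi r A B t → PartsRearr lo hi r A B
  badStep⇒partsRearr (bad _ parts) = parts
  badStep⇒partsRearr {A = A} (notBad _) = A , rearr-refl {A = A} , rearr-refl {A = A}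

  partitionStep⇒agreeOutside : ∀ {lo hi r A A1 A2 A3} → PivotSel lo hi A A1 →
    MovesPivot lo hi r A1 A2 → PartsRearr lo hi r A2 A3 → AgreeOutside lo hi A A3
  partitionStep⇒agreeOutside ps mp parts =
    agreeOutside-trans (agreeOutside-trans (pivotSel⇒agreeOutside ps) (MovesPivot.agreeOutside mp))
      (partsRearr⇒agreeOutside (MovesPivot.lo≤r mp) (MovesPivot.r<hi mp) parts)

  exec⇒agreeOutside : ∀ {t lo hi A A′ es} → Exec t lo hi A A′ es → AgreeOutside lo hi A A′
  exec⇒agreeOutside (insertion _ rr _) = rearr⇒agreeOutside rr
  exec⇒agreeOutside (heapsort _ rr _)  = rearr⇒agreeOutside rr
  exec⇒agreeOutside (partLeft _ ps _ pl bs ex) =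
    let mp = partLeft⇒movesPivot pl in
    agreeOutside-trans (partitionStep⇒agreeOutside ps mp (badStep⇒partsRearr bs))
      (agreeOutside-widen (m≤n⇒m≤1+n (MovesPivot.lo≤r mp)) ≤-refl (exec⇒agreeOutside ex))
  exec⇒agreeOutside (partRightDone _ ps _ pr _ parts _ _) =
    partitionStep⇒agreeOutside ps (partRight⇒movesPivot pr) parts
  exec⇒agreeOutside (partRight _ ps _ pr bs ex₁ ex₂) =
    let mp = partRight⇒movesPivot pr in
    agreeOutside-trans (partitionStep⇒agreeOutside ps mp (badStep⇒partsRearr bs))
      (agreeOutside-parts (MovesPivot.lo≤r mp) (MovesPivot.r<hi mp)
        (exec⇒agreeOutside ex₁) (exec⇒agreeOutside ex₂))
  exec⇒agreeOutside (partRightAbort _ ps _ pr _ parts ex₁ ex₂) =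
    let mp = partRight⇒movesPivot pr in
    agreeOutside-trans (partitionStep⇒agreeOutside ps mp parts)
      (agreeOutside-parts (MovesPivot.lo≤r mp) (MovesPivot.r<hi mp)
        (exec⇒agreeOutside ex₁) (exec⇒agreeOutside ex₂))

module FirstEqualPivot {a ℓ} (C : Set a) (_≺_ : C → C → Set ℓ) (swo : IsStrictWeakOrder _≺_)
  (c pn pd : ℕ) (v : C) where
  open PDQ C _≺_ c pn pd
  open Frame C _≺_ c pn pd
  open IsStrictWeakOrder swo using (incomp-trans)
  open ≡-Reasoning

  ≈-sym : ∀ {x y} → x ≈ y → y ≈ x
  ≈-sym (x⊀y , y⊀x) = y⊀x , x⊀y

  PivotEqualsV : Event → Set ℓ
  PivotEqualsV e = Event.pivot e ≈ v

  SendsVRight : Event → Set ℓ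
  SendsVRight e = Event.kind e ≡ right ×
    (∀ i → Event.lo e ≤ i → i < Event.hi e → i ≢ Event.r e → Event.arr e i ≈ v → Event.r e < i)

  PredNotV : ℕ → Arr → Set ℓ
  PredNotV lo A = ∀ i → suc i ≡ lo → ¬ (A i ≈ v)

  predNotV-transport : ∀ {lo hi A B} → AgreeOutside lo hi A B → PredNotV lo A → PredNotV lo B
  predNotV-transport same notV i refl = notV i refl ∘ subst (_≈ v) (same i (inj₁ (n<1+n i)))

  predNotV-pivot : ∀ {r B q} → B r ≡ q → ¬ q ≈ v → PredNotV (suc r) B
  predNotV-pivot B[r]≡q q≉v _ refl = q≉v ∘ subst (_≈ v) B[r]≡q

  partRight-sendsVRight : ∀ {lo hi r A1 A2} → PartRight lo hi r A1 A2 → A1 lo ≈ v →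
    SendsVRight (event lo hi right (A1 lo) r A2)
  partRight-sendsVRight {lo} {hi} {r} {A1} {A2} (_ , _ , _ , _ , _ , below , _) q≈v = refl , aboveR
    where
    aboveR : ∀ i → lo ≤ i → i < hi → i ≢ r → A2 i ≈ v → r < i
    aboveR i lo≤i _ i≢r x≈v with <-cmp i r
    ... | tri< i<r _ _ = ⊥-elim (proj₁ (incomp-trans x≈v (≈-sym q≈v)) (below i lo≤i i<r))
    ... | tri≈ _ i≡r _ = ⊥-elim (i≢r i≡r)
    ... | tri> _ _ r<i = r<i

  partLeft-pivot≉v : ∀ {lo hi A A1} → PivotSel lo hi A A1 → PredEq lo A1 → PredNotV lo A →
    ¬ A1 lo ≈ v
  partLeft-pivot≉v {zero}   _  (() , _)
  partLeft-pivot≉v {suc lo} ps (_ , pred≈q) notV q≈v =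
    predNotV-transport (pivotSel⇒agreeOutside ps) notV lo refl (incomp-trans pred≈q q≈v)

  SendsVRightAtFirst : List Event → Set (a ⊔ ℓ)
  SendsVRightAtFirst = AtFirst PivotEqualsV SendsVRight

  partRight-sendsVRightAtFirst : ∀ {t lo hi r A A1 A2 A3 A4 es₁ es₂} → PivotSel lo hi A A1 →
    PartRight lo hi r A1 A2 → PartsRearr lo hi r A2 A3 → Exec t lo r A3 A4 es₁ → PredNotV lo A →
    (PredNotV lo A3 → SendsVRightAtFirst es₁) →
    (PredNotV (suc r) A4 → SendsVRightAtFirst es₂) →
    SendsVRightAtFirst (event lo hi right (A1 lo) r A2 ∷ es₁ ++ es₂)
  partRight-sendsVRightAtFirst {lo = lo} {hi = hi} {r = r} {A1 = A1} {A2 = A2} {A3 = A3} {A4 = A4}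
                               ps pr parts ex₁ notV ih₁ ih₂ =
    atFirst-∷ (partRight-sendsVRight pr) λ q≉v →
      atFirst-++ (ih₁ (predNotV-transport (partitionStep⇒agreeOutside ps mp parts) notV))
                 (ih₂ (predNotV-pivot pivot-at-r q≉v))
    where
    mp : MovesPivot lo hi r A1 A2
    mp = partRight⇒movesPivot pr

    pivot-at-r : A4 r ≡ A1 lo
    pivot-at-r = begin
      A4 r ≡⟨ exec⇒agreeOutside ex₁ r (inj₂ ≤-refl) ⟩
      A3 r ≡⟨ partsRearr-at-r parts ⟩
      A2 r ≡⟨ MovesPivot.pivot-at-r mp ⟩
      A1 lo ∎

  exec-sendsVRightAtFirst : ∀ {t lo hi A A′ es} → Exec t lo hi A A′ es → PredNotV lo A →
    SendsVRightAtFirst es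
  exec-sendsVRightAtFirst (insertion _ _ _) _ = atFirst-[]
  exec-sendsVRightAtFirst (heapsort _ _ _)  _ = atFirst-[]
  exec-sendsVRightAtFirst (partLeft {lo = lo} {A1 = A1} {r = r} {A3 = A3} _ ps predEq pl bs ex) notV =
    atFirst-∷ (⊥-elim ∘ partLeft-pivot≉v ps predEq notV) λ q≉v →
      exec-sendsVRightAtFirst ex (predNotV-pivot pivot-at-r q≉v)
    where
    pivot-at-r : A3 r ≡ A1 lo
    pivot-at-r = trans (partsRearr-at-r (badStep⇒partsRearr bs))
                       (MovesPivot.pivot-at-r (partLeft⇒movesPivot pl))
  exec-sendsVRightAtFirst (partRightDone _ _ _ pr _ _ _ _) _ =
    atFirst-∷ (partRight-sendsVRight pr) λ _ → atFirst-[]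
  exec-sendsVRightAtFirst (partRight _ ps _ pr bs ex₁ ex₂) notV =
    partRight-sendsVRightAtFirst ps pr (badStep⇒partsRearr bs) ex₁ notV
      (exec-sendsVRightAtFirst ex₁) (exec-sendsVRightAtFirst ex₂)
  exec-sendsVRightAtFirst (partRightAbort _ ps _ pr _ parts ex₁ ex₂) notV =
    partRight-sendsVRightAtFirst ps pr parts ex₁ notV
      (exec-sendsVRightAtFirst ex₁) (exec-sendsVRightAtFirst ex₂)

corollary1 : ∀ {a ℓ} (C : Set a) (_≺_ : C → C → Set ℓ) → IsStrictWeakOrder _≺_ →
    (c pn pd : ℕ) → 3 ≤ c → 0 < pn → pn < pd →
    let open PDQ C _≺_ c pn pd in
    (n : ℕ) (A A' : Arr) (es : List Event) →
    Exec ⌊log₂ n ⌋ 0 n A A' es →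
    (v : C) (pre post : List Event) (e : Event) →
    es ≡ pre ++ e ∷ post →
    All (λ e′ → ¬ (Event.pivot e′ ≈ v)) pre →
    Event.pivot e ≈ v →
    Event.kind e ≡ right ×
    (∀ i → Event.lo e ≤ i → i < Event.hi e → i ≢ Event.r e →
    Event.arr e i ≈ v → Event.r e < i)
corollary1 C _≺_ swo c pn pd _ _ _ _ _ _ _ ex v pre post e =
  FirstEqualPivot.exec-sendsVRightAtFirst C _≺_ swo c pn pd v ex (λ _ ()) pre e post
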